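{- For every integer $n\ge0$ let $g_n\in\{0,1\}$ be the parity of the number of digits equal to $1$ in the negabinary representation of $n$ (the unique representation $n=\sum_{i\ge0}d_i(-2)^i$ with $d_i\in\{0,1\}$). Then for every integer $m\ge0$: $g_{2^m-1}=0$ if $m=0$; $g_{2^m-1}=1$ if $m=1$; $g_{2^m-1}=1$ if $m\ge2$ is even; and $g_{2^m-1}=0$ if $m\ge3$ is odd. -}

module Defs where

open import Data.Bool using (Bool; true; false; if_then_else_; _xor_)
open import Data.List using (List; []; _∷_)
open import Data.Integer using (ℤ; +_; -_; _+_; _*_)
open import Relation.Binary.PropositionalEquality using (_≡_)
open import Data.Product using (Σ; _×_)

negabinaryValue : List Bool → ℤ
negabinaryValue []       = + 0
negabinaryValue (d ∷ ds) = (if d then + 1 else + 0) + (- (+ 2)) * negabinaryValue ds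

onesParity : List Bool → Bool
onesParity []       = false
onesParity (d ∷ ds) = d xor onesParity ds

IsNegabinaryRep : List Bool → ℤ → Set
IsNegabinaryRep ds n = negabinaryValue ds ≡ n

-- Since the representation
-- is unique up to trailing zeros (which do not affect the count), we say
-- a representation exists and every representation of n has ones-parity b.
GIs : ℤ → Bool → Set
GIs n b = Σ (List Bool) (λ ds → IsNegabinaryRep ds n)
  × ((ds : List Bool) → IsNegabinaryRep ds n → onesParity ds ≡ b)

-- Negabinary representations are unique up to trailing zeros: the lowest digit of n is the
-- parity of n and the remaining digits represent (n - d) / (-2).  So the ones-parity is a
-- function of n, and it suffices to exhibit one representation.  Since 1 1 encodes -1, the
-- string 1 1 0^(m-2) t encodes 2^m - 1 as soon as t encodes (-1)^m: take t = 1 for even m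
-- (three ones) and t = 1 1 for odd m (four ones).

module Submission where

open import Defs

open import Algebra.Bundles using (AbelianGroup)
open import Data.Bool using (Bool; true; false; _xor_; if_then_else_)
open import Data.Bool.Properties using (not-involutive)
open import Data.Empty using (⊥-elim)
open import Data.Integer using (ℤ; +_; -_; _+_; _-_; _*_; _⊖_; ∣_∣; -1ℤ) renaming (_^_ to _^ℤ_)
open import Data.Integer.Properties
  using ( *-cancelˡ-≡; ∣i*j∣≡∣i∣*∣j∣; +-identityˡ; *-identityˡ; *-identityʳ; *-assoc; *-comm
        ; pos-*; neg-distribˡ-*; neg-involutive; -1*i≡-i; m-n≡m⊖n; ⊖-≥; ^-*-assoc; +-0-abelianGroup )
open import Data.Integer.Tactic.RingSolver using (solve-∀)
open import Data.List using ([]; _∷_; _++_; replicate)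
open import Data.Nat as ℕ using (ℕ; zero; suc; _^_; _≤_; _∸_; s≤s)
import Data.Nat.Properties as ℕ
open import Data.Nat.Divisibility using (_∣_; divides; _∣0; ∣-refl; ∣m∣n⇒∣m+n)
open import Data.Product using (_×_; _,_)
open import Data.Sum using (_⊎_; inj₁; inj₂)
open import Relation.Nullary using (¬_)
open import Relation.Binary.PropositionalEquality
  using (_≡_; _≢_; refl; sym; trans; cong; module ≡-Reasoning)

open import Algebra.Properties.Group (AbelianGroup.group +-0-abelianGroup) using (∙-cancelˡ)
open ≡-Reasoning

digit : Bool → ℤ
digit b = if b then + 1 else + 0

1≢2*i : ∀ i → + 1 ≢ + 2 * i
1≢2*i i eq with () ← ℕ.m*n≡1⇒m≡1 2 ∣ i ∣ (sym (trans (cong ∣_∣ eq) (∣i*j∣≡∣i∣*∣j∣ (+ 2) i)))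

negabinary-step-injective : ∀ b c x y → digit b + - + 2 * x ≡ digit c + - + 2 * y → b ≡ c × x ≡ y
negabinary-step-injective true  true  x y eq = refl , *-cancelˡ-≡ (- + 2) x y (∙-cancelˡ (+ 1) _ _ eq)
negabinary-step-injective false false x y eq = refl , *-cancelˡ-≡ (- + 2) x y (∙-cancelˡ (+ 0) _ _ eq)
negabinary-step-injective true  false x y eq = ⊥-elim (1≢2*i (x - y) (begin
  + 1                        ≡⟨ add-2x x ⟩
  + 1 + - + 2 * x + + 2 * x  ≡⟨ cong (_+ + 2 * x) eq ⟩
  + 0 + - + 2 * y + + 2 * x  ≡⟨ collect x y ⟩
  + 2 * (x - y)              ∎))
  where
  add-2x : ∀ x → + 1 ≡ + 1 + - + 2 * x + + 2 * x
  add-2x = solve-∀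
  collect : ∀ x y → + 0 + - + 2 * y + + 2 * x ≡ + 2 * (x - y)
  collect = solve-∀
negabinary-step-injective false true  x y eq =
  let c≡b , y≡x = negabinary-step-injective true false y x (sym eq) in sym c≡b , sym y≡x

onesParity-unique : ∀ ds es → negabinaryValue ds ≡ negabinaryValue es → onesParity ds ≡ onesParity es
onesParity-unique []       []       _  = refl
onesParity-unique []       (e ∷ es) eq
  with refl , eq′ ← negabinary-step-injective false e (+ 0) (negabinaryValue es) eq =
  onesParity-unique [] es eq′
onesParity-unique (d ∷ ds) []       eq
  with refl , eq′ ← negabinary-step-injective d false (negabinaryValue ds) (+ 0) eq =
  onesParity-unique ds [] eq′
onesParity-unique (d ∷ ds) (e ∷ es) eq
  with refl , eq′ ← negabinary-step-injective d e (negabinaryValue ds) (negabinaryValue es) eq =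
  cong (d xor_) (onesParity-unique ds es eq′)

GIs-intro : ∀ {n b} ds → IsNegabinaryRep ds n → onesParity ds ≡ b → GIs n b
GIs-intro ds ds↦n ds-parity =
  (ds , ds↦n) , λ es es↦n → trans (onesParity-unique es ds (trans es↦n (sym ds↦n))) ds-parity

2∣n⊎2∣1+n : ∀ n → (2 ∣ n) ⊎ (2 ∣ suc n)
2∣n⊎2∣1+n zero = inj₁ (2 ∣0)
2∣n⊎2∣1+n (suc n) with 2∣n⊎2∣1+n n
... | inj₁ 2∣n   = inj₂ (∣m∣n⇒∣m+n ∣-refl 2∣n)
... | inj₂ 2∣1+n = inj₁ 2∣1+n

pos-^ : ∀ m n → + (m ^ n) ≡ (+ m) ^ℤ n
pos-^ m zero    = refl
pos-^ m (suc n) = trans (pos-* m (m ^ n)) (cong (+ m *_) (pos-^ m n))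

neg-^-even : ∀ i {n} → 2 ∣ n → (- i) ^ℤ n ≡ i ^ℤ n
neg-^-even i (divides q refl) = begin
  (- i) ^ℤ (q ℕ.* 2)   ≡⟨ cong ((- i) ^ℤ_) (ℕ.*-comm q 2) ⟩
  (- i) ^ℤ (2 ℕ.* q)   ≡⟨ ^-*-assoc (- i) 2 q ⟨
  ((- i) ^ℤ 2) ^ℤ q    ≡⟨ cong (_^ℤ q) (neg-square i) ⟩
  (i ^ℤ 2) ^ℤ q        ≡⟨ ^-*-assoc i 2 q ⟩
  i ^ℤ (2 ℕ.* q)       ≡⟨ cong (i ^ℤ_) (ℕ.*-comm 2 q) ⟩
  i ^ℤ (q ℕ.* 2)       ∎
  where
  -- (- i) ^ℤ 2 ≡ i ^ℤ 2 with the powers unfolded, since the ring solver does not handle _^ℤ_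
  neg-square : ∀ i → - i * (- i * + 1) ≡ i * (i * + 1)
  neg-square = solve-∀

neg-^-odd : ∀ i {n} → 2 ∣ n → (- i) ^ℤ suc n ≡ - (i ^ℤ suc n)
neg-^-odd i {n} 2∣n = begin
  - i * (- i) ^ℤ n   ≡⟨ cong (- i *_) (neg-^-even i 2∣n) ⟩
  - i * i ^ℤ n       ≡⟨ neg-distribˡ-* i (i ^ℤ n) ⟨
  - (i * i ^ℤ n)     ∎

negabinaryValue-padded : ∀ n ds →
  negabinaryValue (replicate n false ++ ds) ≡ (- + 2) ^ℤ n * negabinaryValue ds
negabinaryValue-padded zero    ds = sym (*-identityˡ (negabinaryValue ds))
negabinaryValue-padded (suc n) ds = begin
  + 0 + - + 2 * negabinaryValue (replicate n false ++ ds)  ≡⟨ +-identityˡ _ ⟩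
  - + 2 * negabinaryValue (replicate n false ++ ds)        ≡⟨ cong (- + 2 *_) (negabinaryValue-padded n ds) ⟩
  - + 2 * ((- + 2) ^ℤ n * negabinaryValue ds)              ≡⟨ *-assoc (- + 2) ((- + 2) ^ℤ n) _ ⟨
  (- + 2) ^ℤ suc n * negabinaryValue ds                    ∎

onesParity-padded : ∀ n ds → onesParity (replicate n false ++ ds) ≡ onesParity ds
onesParity-padded zero    ds = refl
onesParity-padded (suc n) ds = onesParity-padded n ds

GIs-2^[2+n]∸1 : ∀ n ds → (- + 2) ^ℤ (2 ℕ.+ n) * negabinaryValue ds ≡ + (2 ^ (2 ℕ.+ n))
              → GIs (+ (2 ^ (2 ℕ.+ n) ∸ 1)) (onesParity ds)
GIs-2^[2+n]∸1 n ds top≡2^m = GIs-intro (true ∷ true ∷ replicate n false ++ ds) value parity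
  where
  m : ℕ
  m = 2 ℕ.+ n
  shift : ∀ p v → + 1 + - + 2 * (+ 1 + - + 2 * (p * v)) ≡ - + 2 * (- + 2 * p) * v - + 1
  shift = solve-∀
  value : negabinaryValue (true ∷ true ∷ replicate n false ++ ds) ≡ + (2 ^ m ∸ 1)
  value = begin
    + 1 + - + 2 * (+ 1 + - + 2 * negabinaryValue (replicate n false ++ ds))
      ≡⟨ cong (λ v → + 1 + - + 2 * (+ 1 + - + 2 * v)) (negabinaryValue-padded n ds) ⟩
    + 1 + - + 2 * (+ 1 + - + 2 * ((- + 2) ^ℤ n * negabinaryValue ds))
      ≡⟨ shift ((- + 2) ^ℤ n) (negabinaryValue ds) ⟩
    (- + 2) ^ℤ m * negabinaryValue ds - + 1  ≡⟨ cong (_- + 1) top≡2^m ⟩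
    + (2 ^ m) - + 1                          ≡⟨ m-n≡m⊖n (2 ^ m) 1 ⟩
    2 ^ m ⊖ 1                                ≡⟨ ⊖-≥ (ℕ.m^n>0 2 m) ⟩
    + (2 ^ m ∸ 1)                            ∎
  parity : onesParity (true ∷ true ∷ replicate n false ++ ds) ≡ onesParity ds
  parity = trans (not-involutive _) (onesParity-padded n ds)

GIs-2^[2+n]∸1-even : ∀ n → 2 ∣ 2 ℕ.+ n → GIs (+ (2 ^ (2 ℕ.+ n) ∸ 1)) true
GIs-2^[2+n]∸1-even n 2∣2+n = GIs-2^[2+n]∸1 n (true ∷ []) (begin
  (- + 2) ^ℤ (2 ℕ.+ n) * + 1  ≡⟨ *-identityʳ _ ⟩
  (- + 2) ^ℤ (2 ℕ.+ n)        ≡⟨ neg-^-even (+ 2) 2∣2+n ⟩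
  (+ 2) ^ℤ (2 ℕ.+ n)          ≡⟨ pos-^ 2 (2 ℕ.+ n) ⟨
  + (2 ^ (2 ℕ.+ n))           ∎)

GIs-2^[2+n]∸1-odd : ∀ n → 2 ∣ 1 ℕ.+ n → GIs (+ (2 ^ (2 ℕ.+ n) ∸ 1)) false
GIs-2^[2+n]∸1-odd n 2∣1+n = GIs-2^[2+n]∸1 n (true ∷ true ∷ []) (begin
  (- + 2) ^ℤ (2 ℕ.+ n) * -1ℤ  ≡⟨ *-comm ((- + 2) ^ℤ (2 ℕ.+ n)) -1ℤ ⟩
  -1ℤ * (- + 2) ^ℤ (2 ℕ.+ n)  ≡⟨ -1*i≡-i _ ⟩
  - ((- + 2) ^ℤ (2 ℕ.+ n))    ≡⟨ cong -_ (neg-^-odd (+ 2) 2∣1+n) ⟩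
  - - ((+ 2) ^ℤ (2 ℕ.+ n))    ≡⟨ neg-involutive _ ⟩
  (+ 2) ^ℤ (2 ℕ.+ n)          ≡⟨ pos-^ 2 (2 ℕ.+ n) ⟨
  + (2 ^ (2 ℕ.+ n))           ∎)

corollary1 : (m : ℕ) →
    (m ≡ 0 → GIs (+ (2 ^ m ∸ 1)) false)
    × (m ≡ 1 → GIs (+ (2 ^ m ∸ 1)) true)
    × (2 ≤ m → 2 ∣ m → GIs (+ (2 ^ m ∸ 1)) true)
    × (3 ≤ m → ¬ (2 ∣ m) → GIs (+ (2 ^ m ∸ 1)) false)
corollary1 m = m≡0 , m≡1 , even m , odd m
  where
  m≡0 : ∀ {m} → m ≡ 0 → GIs (+ (2 ^ m ∸ 1)) false
  m≡0 refl = GIs-intro [] refl refl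
  m≡1 : ∀ {m} → m ≡ 1 → GIs (+ (2 ^ m ∸ 1)) true
  m≡1 refl = GIs-intro (true ∷ []) refl refl
  even : ∀ m → 2 ≤ m → 2 ∣ m → GIs (+ (2 ^ m ∸ 1)) true
  even (suc zero)    (s≤s ()) _
  even (suc (suc n)) _        2∣m = GIs-2^[2+n]∸1-even n 2∣m
  odd : ∀ m → 3 ≤ m → ¬ (2 ∣ m) → GIs (+ (2 ^ m ∸ 1)) false
  odd (suc zero)    (s≤s ()) _
  odd (suc (suc n)) _        2∤m with 2∣n⊎2∣1+n (suc n)
  ... | inj₁ 2∣1+n = GIs-2^[2+n]∸1-odd n 2∣1+n
  ... | inj₂ 2∣m   = ⊥-elim (2∤m 2∣m)
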